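{- Let $\mathcal{G}_1$ and $\mathcal{G}_2$ be the graphs on the vertex set $\{1,2,\ldots,16\}$ defined below, and let $\mathfrak{G}=\mathcal{G}_1^2$ (which equals $\mathcal{G}_2^2$). If $H$ is a graph on the vertex set $\{1,\ldots,16\}$ with girth $g(H)=5$ and $H^2=\mathfrak{G}$, then $H$ is isomorphic either to $\mathcal{G}_1$ or to $\mathcal{G}_2$.
   Context: For a graph $H$, the square $H^2$ is the graph on the same vertex set in which distinct $x,y$ are adjacent iff their distance in $H$ is at most $2$. The girth $g(H)$ is the length of a shortest cycle of $H$. $\mathcal{G}_1$ has the 24 edges $1\text{ - }7, 1\text{ - }11, 1\text{ - }12, 2\text{ - }8, 2\text{ - }12, 2\text{ - }15, 3\text{ - }9, 3\text{ - }12, 3\text{ - }16, 4\text{ - }10, 4\text{ - }14, 4\text{ - }15, 5\text{ - }11, 5\text{ - }13, 5\text{ - }15, 6\text{ - }13, 6\text{ - }14, 7\text{ - }13, 8\text{ - }14, 8\text{ - }16, 9\text{ - }15, 10\text{ - }16, 11\text{ - }14, 13\text{ - }16$. $\mathcal{G}_2$ has the 24 edges $1\text{ - }7, 1\text{ - }11, 1\text{ - }12, 2\text{ - }8, 2\text{ - }12, 2\text{ - }16, 3\text{ - }9, 3\text{ - }12, 3\text{ - }15, 4\text{ - }10, 4\text{ - }14, 4\text{ - }16, 5\text{ - }6, 5\text{ - }7, 5\text{ - }13, 5\text{ - }16, 6\text{ - }14, 8\text{ - }14, 8\text{ - }15, 9\text{ - }16, 10\text{ - }15, 11\text{ - }13,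 11\text{ - }14, 13\text{ - }15$. Both have girth $5$ and $\mathcal{G}_1^2=\mathcal{G}_2^2$. -}

module Defs where

open import Data.Nat using (ℕ; zero; suc; _≡ᵇ_; _<_; _≤_)
open import Data.Bool using (Bool; true; false; _∧_; _∨_; not; T)
open import Data.Fin using (Fin; zero; suc; toℕ; inject₁; fromℕ; _≟_)
open import Data.List using (List; []; _∷_; allFin)
open import Data.Bool.ListAction using (any)
open import Data.Empty using (⊥)
open import Data.Product using (_×_; _,_; Σ; ∃)
open import Function.Definitions using (Injective)
open import Function.Bundles using (_↔_; Inverse)
open import Relation.Nullary using (¬_)
open import Relation.Nullary.Decidable using (⌊_⌋)
open import Relation.Binary.PropositionalEquality using (_≡_)

-- A graph on the vertex set Fin n (vertex k+1 of the paper = Fin element k),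
-- given by a Bool-valued adjacency matrix.
Graph : ℕ → Set
Graph n = Fin n → Fin n → Bool

IsSimple : ∀ {n} → Graph n → Set
IsSimple {n} A = (∀ (x y : Fin n) → A x y ≡ A y x) × (∀ (x : Fin n) → A x x ≡ false)

-- graph on Fin 16 from an edge list written with the paper's labels 1..16
fromEdges : List (ℕ × ℕ) → Graph 16
fromEdges es x y = any match es
  where
    match : ℕ × ℕ → Bool
    match (a , b) = ((a ≡ᵇ suc (toℕ x)) ∧ (b ≡ᵇ suc (toℕ y)))
                  ∨ ((b ≡ᵇ suc (toℕ x)) ∧ (a ≡ᵇ suc (toℕ y)))

square : ∀ {n} → Graph n → Graph n
square {n} A x y = not ⌊ x ≟ y ⌋ ∧ (A x y ∨ any (λ z → A x z ∧ A z y) (allFin n))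

-- A cycle of length (suc k) in A: pairwise distinct vertices c 0, …, c k with
-- c i ~ c (i+1) for i < k and c k ~ c 0; a cycle has length at least 3.
record Cycle {n} (A : Graph n) (k : ℕ) : Set where
  field
    len≥3  : 2 ≤ k
    vertex : Fin (suc k) → Fin n
    distinct : Injective _≡_ _≡_ vertex
    step   : ∀ (i : Fin k) → T (A (vertex (inject₁ i)) (vertex (suc i)))
    close  : T (A (vertex (fromℕ k)) (vertex zero))

HasCycleOfLength : ∀ {n} → Graph n → ℕ → Set
HasCycleOfLength A zero = ⊥
HasCycleOfLength A (suc k) = Cycle A k

Girth≡ : ∀ {n} → Graph n → ℕ → Set
Girth≡ A g = HasCycleOfLength A g × (∀ m → m < g → ¬ HasCycleOfLength A m)

Isomorphic : ∀ {n} → Graph n → Graph n → Set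
Isomorphic {n} A B = Σ (Fin n ↔ Fin n) λ f →
  ∀ (x y : Fin n) → A x y ≡ B (Inverse.to f x) (Inverse.to f y)

𝒢₁ : Graph 16
𝒢₁ = fromEdges
  ( (1 , 7) ∷ (1 , 11) ∷ (1 , 12) ∷ (2 , 8) ∷ (2 , 12) ∷ (2 , 15) ∷ (3 , 9) ∷ (3 , 12)
  ∷ (3 , 16) ∷ (4 , 10) ∷ (4 , 14) ∷ (4 , 15) ∷ (5 , 11) ∷ (5 , 13) ∷ (5 , 15) ∷ (6 , 13)
  ∷ (6 , 14) ∷ (7 , 13) ∷ (8 , 14) ∷ (8 , 16) ∷ (9 , 15) ∷ (10 , 16) ∷ (11 , 14) ∷ (13 , 16) ∷ [])

𝒢₂ : Graph 16
𝒢₂ = fromEdges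
  ( (1 , 7) ∷ (1 , 11) ∷ (1 , 12) ∷ (2 , 8) ∷ (2 , 12) ∷ (2 , 16) ∷ (3 , 9) ∷ (3 , 12)
  ∷ (3 , 15) ∷ (4 , 10) ∷ (4 , 14) ∷ (4 , 16) ∷ (5 , 6) ∷ (5 , 7) ∷ (5 , 13) ∷ (5 , 16)
  ∷ (6 , 14) ∷ (8 , 14) ∷ (8 , 15) ∷ (9 , 16) ∷ (10 , 15) ∷ (11 , 13) ∷ (11 , 14) ∷ (13 , 15) ∷ [])

𝔊 : Graph 16
𝔊 = square 𝒢₁

-- Every edge of H is an edge of H² = 𝔊, so H is a choice of a subset of the edges of 𝔊.
-- The certificate below is a decision tree over these choices that records, along each branch,
-- which pairs are edges of H. A branch is closed as soon as the recorded edges force H² ≠ 𝔊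
-- (an edge of 𝔊 none of whose paths of length ≤ 2 survives, or a recorded path x–z–y with
-- xy ∉ 𝔊) or contain a triangle or a 4-cycle, contradicting girth 5. The surviving leaves
-- determine H completely, and each is 𝒢₁ or 𝒢₂ itself, so H is in fact equal to one of them.

module Submission where

open import Agda.Builtin.FromNat using (Number; fromNat)
open import Data.Bool using (Bool; true; false; T; not; _∧_; _∨_; if_then_else_)
open import Data.Bool.ListAction using (all; any)
open import Data.Bool.Properties using (T-∧; T-∨; T-≡; T-not-≡) renaming (_≟_ to _≟ᵇ_)
open import Data.Empty using (⊥-elim)
open import Data.Unit using (tt)
open import Data.Fin using (Fin; zero; suc; inject₁; fromℕ; _≟_)
import Data.Fin.Literals as FinLiterals
open import Data.List using (List; []; _∷_; allFin)
open import Data.List.Membership.Propositional using (_∈_; lose)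
open import Data.List.Membership.Propositional.Properties using (∈-allFin)
import Data.List.Relation.Unary.All as All
open import Data.List.Relation.Unary.All.Properties using (all⁺)
open import Data.List.Relation.Unary.Any as Any using (Any; here; there; satisfied)
open import Data.List.Relation.Unary.Any.Properties using (any⁺; any⁻)
open import Data.Maybe using (Maybe; just; nothing)
open import Data.Nat using (ℕ; suc; _<_; _≤_; _≤ᵇ_; _<ᵇ_)
import Data.Nat.Literals as NatLiterals
open import Data.Nat.Properties using (≤ᵇ⇒≤; <ᵇ⇒<)
open import Data.Product using (_×_; _,_; proj₁; proj₂; ∃-syntax)
open import Data.Sum using (_⊎_; inj₁; inj₂)
open import Data.Vec using (Vec; []; _∷_; lookup)
open import Data.Vec.Relation.Unary.AllPairs using (allPairs?)
open import Data.Vec.Relation.Unary.Linked as Linked using (Linked; _∷_; linked?)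
open import Data.Vec.Relation.Unary.Unique.Propositional using (Unique)
open import Data.Vec.Relation.Unary.Unique.Propositional.Properties using (lookup-injective)
open import Function.Bundles using (Equivalence)
open import Function.Construct.Identity using (↔-id)
open import Relation.Binary.Core using (Rel)
open import Relation.Binary.PropositionalEquality using (_≡_; _≢_; refl; sym; trans; subst)
open import Relation.Nullary using (¬_; yes; no; ¬?)
open import Relation.Nullary.Decidable using (⌊_⌋; _×-dec_; _⊎-dec_; T?; toWitness; toWitnessFalse; fromWitnessFalse)

open import Defs

open Equivalence using (to; from)

-- With fromNat in scope every numeral is overloaded (the ⊤ constraint of ℕ numerals is met by the
-- instance tt); the Fin 16 numerals are the certificate's vertices, numbered from 0 as in Defs.
instance
  ℕ-literals : Number ℕ
  ℕ-literals = NatLiterals.number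

  fin-literals : Number (Fin 16)
  fin-literals = FinLiterals.number 16

module _ {n : ℕ} (A : Graph n) where

  square⇒adjacent⊎path : ∀ x y → T (square A x y) →
                T (A x y) ⊎ ∃[ z ] (T (A x z) × T (A z y))
  square⇒adjacent⊎path x y x~y with to T-∨ (proj₂ (to (T-∧ {not ⌊ x ≟ y ⌋}) x~y))
  ... | inj₁ xy = inj₁ xy
  ... | inj₂ xzy with satisfied (any⁻ _ (allFin n) xzy)
  ...   | z , xz∧zy = inj₂ (z , to T-∧ xz∧zy)

  path⇒square : ∀ {x y z} → x ≢ y → T (A x z) → T (A z y) → T (square A x y)
  path⇒square {x} {y} {z} x≢y xz zy =
    from (T-∧ {not ⌊ x ≟ y ⌋}) (fromWitnessFalse x≢y , from (T-∨ {A x y}) (inj₂ via-z))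
    where
    via-z : T (any (λ w → A x w ∧ A w y) (allFin n))
    via-z = any⁺ _ (lose (∈-allFin z) (from T-∧ (xz , zy)))

  adjacent⇒square : (∀ x → A x x ≡ false) → ∀ {x y} → T (A x y) → T (square A x y)
  adjacent⇒square loopless {x} {y} xy =
    from (T-∧ {not ⌊ x ≟ y ⌋}) (fromWitnessFalse x≢y , from (T-∨ {A x y}) (inj₁ xy))
    where
    x≢y : x ≢ y
    x≢y refl = subst T (loopless x) xy

T-allFin : ∀ {n} {p : Fin n → Bool} → T (all p (allFin n)) → ∀ i → T (p i)
T-allFin {p = p} ok i = All.lookup (all⁺ p _ ok) (∈-allFin i)

Linked⇒lookup : ∀ {a ℓ} {X : Set a} {R : Rel X ℓ} {k} {xs : Vec X (suc k)} →
                Linked R xs → ∀ (i : Fin k) → R (lookup xs (inject₁ i)) (lookup xs (suc i))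
Linked⇒lookup {xs = _ ∷ _ ∷ _} (r ∷ _)  zero    = r
Linked⇒lookup {xs = _ ∷ _ ∷ _} (_ ∷ rs) (suc i) = Linked⇒lookup rs i

closedWalk⇒Cycle : ∀ {n k} {A : Graph n} (vs : Vec (Fin n) (suc k)) → 2 ≤ k → Unique vs →
                   Linked (λ u v → T (A u v)) vs → T (A (lookup vs (fromℕ k)) (lookup vs zero)) →
                   Cycle A k
closedWalk⇒Cycle vs 2≤k unique walk closing = record
  { len≥3    = 2≤k
  ; vertex   = lookup vs
  ; distinct = λ {i} {j} → lookup-injective unique i j
  ; step     = Linked⇒lookup walk
  ; close    = closing
  }

≗⇒Isomorphic : ∀ {n} {A B : Graph n} → (∀ x y → A x y ≡ B x y) → Isomorphic A B
≗⇒Isomorphic A≗B = ↔-id _ , A≗B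

module Search {n : ℕ} (S : Graph n) (g : ℕ) (candidates : List (Graph n)) where

  Knowledge : Set
  Knowledge = Fin n → Fin n → Maybe Bool

  _is_ : Maybe Bool → Bool → Bool
  just a  is b = ⌊ a ≟ᵇ b ⌋
  nothing is b = false

  initial : Knowledge
  initial x y = if S x y then nothing else just false

  learn : Knowledge → Fin n → Fin n → Bool → Knowledge
  learn ρ x y b u v with (u ≟ x ×-dec v ≟ y) ⊎-dec (u ≟ y ×-dec v ≟ x)
  ... | yes _ = just b
  ... | no  _ = ρ u v

  data Certificate : Set where
    split      : Fin n → Fin n → Certificate → Certificate → Certificate
    unrealised : Fin n → Fin n → Certificate
    spurious   : Fin n → Fin n → Fin n → Certificate
    shortCycle : ∀ {k} → Vec (Fin n) (suc k) → Certificate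
    found      : ∀ {G} → G ∈ candidates → Certificate

  allVertices : (Fin n → Bool) → Bool
  allVertices p = all p (allFin n)

  check : Knowledge → Certificate → Bool
  check ρ (split x y c d)     = check (learn ρ x y true) c ∧ check (learn ρ x y false) d
  check ρ (unrealised x y)    = S x y ∧ (ρ x y is false ∧ allVertices λ z → ρ x z is false ∨ ρ z y is false)
  check ρ (spurious x z y)    = not (S x y) ∧ (not ⌊ x ≟ y ⌋ ∧ (ρ x z is true ∧ ρ z y is true))
  check ρ (shortCycle {k} vs) =
    ((2 ≤ᵇ k) ∧ (suc k <ᵇ g)) ∧ (⌊ allPairs? (λ u v → ¬? (u ≟ v)) vs ⌋
      ∧ (⌊ linked? (λ u v → T? (ρ u v is true)) vs ⌋ ∧ ρ (lookup vs (fromℕ k)) (lookup vs zero) is true))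
  check ρ (found {G} _)       = allVertices λ x → allVertices λ y → ρ x y is G x y

  module Soundness (H : Graph n) (simple : IsSimple H)
                   (no-short-cycle : ∀ m → m < g → ¬ HasCycleOfLength H m)
                   (H²≡S : ∀ x y → square H x y ≡ S x y) where

    record Consistent (ρ : Knowledge) : Set where
      field agrees : ∀ {u v b} → T (ρ u v is b) → H u v ≡ b

    open Consistent

    initial-consistent : Consistent initial
    agrees initial-consistent {u} {v} known with S u v in Suv | H u v in Huv
    ... | false | false = toWitness known
    ... | false | true  = ⊥-elim (subst T Suv (subst T (H²≡S u v) (adjacent⇒square H (proj₂ simple) uv)))
      where
      uv : T (H u v)
      uv = from T-≡ Huv

    learn-consistent : ∀ {ρ x y b} → Consistent ρ → H x y ≡ b → Consistent (learn ρ x y b)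
    agrees (learn-consistent {ρ} {x} {y} ρ-consistent Hxy) {u} {v} known
      with (u ≟ x ×-dec v ≟ y) ⊎-dec (u ≟ y ×-dec v ≟ x)
    ... | yes (inj₁ (refl , refl)) = trans Hxy (toWitness known)
    ... | yes (inj₂ (refl , refl)) = trans (proj₁ simple y x) (trans Hxy (toWitness known))
    ... | no  _                    = agrees ρ-consistent known

    module _ {ρ : Knowledge} (ρ-consistent : Consistent ρ) where

      known-edge : ∀ {u v} → T (ρ u v is true) → T (H u v)
      known-edge known = from T-≡ (agrees ρ-consistent known)

      known-non-edge : ∀ {u v} → T (ρ u v is false) → ¬ T (H u v)
      known-non-edge known uv = subst T (agrees ρ-consistent known) uv

      unrealised-impossible : ∀ x y → ¬ T (check ρ (unrealised x y))
      unrealised-impossible x y ok with to (T-∧ {S x y}) ok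
      ... | xy∈S , rest with to (T-∧ {ρ x y is false}) rest
      ...   | xy∉H , no-path with square⇒adjacent⊎path H x y (subst T (sym (H²≡S x y)) xy∈S)
      ...     | inj₁ xy = known-non-edge xy∉H xy
      ...     | inj₂ (z , xz , zy) with to T-∨ (T-allFin no-path z)
      ...       | inj₁ xz∉H = known-non-edge xz∉H xz
      ...       | inj₂ zy∉H = known-non-edge zy∉H zy

      spurious-impossible : ∀ x z y → ¬ T (check ρ (spurious x z y))
      spurious-impossible x z y ok with to (T-∧ {not (S x y)}) ok
      ... | xy∉S , rest with to (T-∧ {not ⌊ x ≟ y ⌋}) rest
      ...   | x≢y , path with to (T-∧ {ρ x z is true}) path
      ...     | xz , zy = subst T (to T-not-≡ xy∉S) (subst T (H²≡S x y) xy∈H²)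
        where
        xy∈H² : T (square H x y)
        xy∈H² = path⇒square H (toWitnessFalse x≢y) (known-edge xz) (known-edge zy)

      shortCycle-impossible : ∀ {k} (vs : Vec (Fin n) (suc k)) → ¬ T (check ρ (shortCycle vs))
      shortCycle-impossible {k} vs ok with to (T-∧ {(2 ≤ᵇ k) ∧ (suc k <ᵇ g)}) ok
      ... | lengths , rest with to (T-∧ {2 ≤ᵇ k}) lengths | to (T-∧ {⌊ allPairs? (λ u v → ¬? (u ≟ v)) vs ⌋}) rest
      ...   | 2≤k , short | distinct , closedWalk with to (T-∧ {⌊ linked? (λ u v → T? (ρ u v is true)) vs ⌋}) closedWalk
      ...     | walk , closing =
        no-short-cycle (suc k) (<ᵇ⇒< (suc k) g short)
          (closedWalk⇒Cycle vs (≤ᵇ⇒≤ 2 k 2≤k) (toWitness distinct)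
            (Linked.map known-edge (toWitness walk)) (known-edge closing))

      found-agrees : ∀ {G} (G∈ : G ∈ candidates) → T (check ρ (found G∈)) → ∀ x y → H x y ≡ G x y
      found-agrees G∈ ok x y = agrees ρ-consistent (T-allFin (T-allFin ok x) y)

    sound : ∀ {ρ} (c : Certificate) → Consistent ρ → T (check ρ c) →
            Any (λ G → ∀ x y → H x y ≡ G x y) candidates
    sound {ρ} (split x y c d) ρ-consistent ok with H x y in Hxy | to (T-∧ {check (learn ρ x y true) c}) ok
    ... | true  | ok-c , _ = sound c (learn-consistent ρ-consistent Hxy) ok-c
    ... | false | _ , ok-d = sound d (learn-consistent ρ-consistent Hxy) ok-d
    sound (unrealised x y) ρ-consistent ok = ⊥-elim (unrealised-impossible ρ-consistent x y ok)
    sound (spurious x z y) ρ-consistent ok = ⊥-elim (spurious-impossible ρ-consistent x z y ok)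
    sound (shortCycle vs)  ρ-consistent ok = ⊥-elim (shortCycle-impossible ρ-consistent vs ok)
    sound (found G∈)       ρ-consistent ok = Any.map (λ { refl → found-agrees ρ-consistent G∈ ok }) G∈

open Search 𝔊 5 (𝒢₁ ∷ 𝒢₂ ∷ [])

certificate : Certificate
certificate =
  (split 0 1 (split 1 3 (spurious 0 1 3) (split 1 7 (spurious 0 1 7) (split 1 8 (spurious 0 1 8)
  (split 1 14 (spurious 0 1 14) (split 1 15 (spurious 0 1 15) (split 0 6 (spurious 1 0 6) (split 0
  10 (spurious 1 0 10) (split 0 12 (spurious 1 0 12) (split 0 4 (split 3 4 (spurious 0 4 3) (split 1
  13 (split 3 13 (split 0 13 (spurious 0 13 3) (split 4 5 (spurious 0 4 5) (split 4 8 (spurious 0 4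
  8) (split 4 14 (spurious 0 4 14) (split 4 15 (spurious 0 4 15) (unrealised 4 8)))))) (unrealised 1
  3)) (unrealised 1 3))) (split 0 11 (split 6 11 (split 7 11 (spurious 0 11 7) (split 8 11 (spurious
  0 11 8) (split 11 14 (spurious 0 11 14) (split 11 15 (spurious 0 11 15) (split 2 8 (split 2 11
  (spurious 2 11 6) (unrealised 8 11)) (unrealised 8 11)))))) (unrealised 0 6)) (unrealised 0
  6))))))))))) (split 0 2 (split 2 7 (spurious 0 2 7) (split 2 8 (spurious 0 2 8) (split 2 9
  (spurious 0 2 9) (split 2 14 (spurious 0 2 14) (split 2 15 (spurious 0 2 15) (split 2 12 (split 9
  12 (split 0 12 (spurious 0 12 9) (split 1 2 (spurious 1 2 12) (split 1 11 (split 2 11 (spurious 11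
  2 12) (unrealised 1 2)) (unrealised 1 2)))) (unrealised 2 9)) (unrealised 2 9))))))) (split 0 11
  (split 7 11 (spurious 0 11 7) (split 8 11 (spurious 0 11 8) (split 11 14 (spurious 0 11 14) (split
  11 15 (spurious 0 11 15) (split 0 4 (spurious 4 0 11) (split 0 12 (spurious 11 0 12) (split 2 11
  (split 6 11 (spurious 2 11 6) (split 10 11 (spurious 2 11 10) (split 0 6 (split 0 10 (split 3 10
  (spurious 0 10 3) (split 5 6 (spurious 0 6 5) (split 5 10 (spurious 0 10 5) (split 7 10 (spurious
  0 10 7) (split 10 14 (spurious 0 10 14) (split 6 15 (spurious 0 6 15) (split 0 13 (spurious 6 0
  13) (split 1 11 (split 10 13 (split 1 13 (spurious 1 13 10) (split 1 3 (spurious 3 1 11) (split 1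
  4 (spurious 4 1 11) (split 6 10 (spurious 6 10 13) (split 9 13 (spurious 9 13 10) (split 2 9
  (spurious 9 2 11) (split 13 15 (spurious 10 13 15) (split 2 12 (spurious 11 2 12) (split 1 2
  (shortCycle (1 ∷ 2 ∷ 11 ∷ [])) (split 4 6 (split 3 4 (spurious 3 4 6) (split 3 13 (split 12 13
  (spurious 3 13 12) (split 4 8 (spurious 6 4 8) (split 4 13 (spurious 6 4 13) (split 4 14 (spurious
  6 4 14) (split 1 15 (split 4 15 (split 8 15 (split 4 12 (split 12 14 (split 5 15 (spurious 1 15 5)
  (split 9 15 (spurious 1 15 9) (split 1 14 (spurious 1 14 12) (split 1 7 (split 7 13 (split 2 14
  (split 5 7 (spurious 1 7 5) (split 7 9 (spurious 1 7 9) (split 9 14 (split 7 12 (spurious 1 7 12)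
  (split 12 15 (spurious 1 15 12) (split 7 14 (split 3 9 (split 3 15 (split 3 14 (spurious 2 14 3)
  (split 2 15 (spurious 2 15 3) (split 2 7 (spurious 2 7 13) (split 2 8 (split 3 8 (spurious 2 8 3)
  (split 13 14 (spurious 2 14 13) (split 10 12 (split 9 12 (spurious 3 9 12) (split 7 15 (spurious 4
  15 7) (split 3 5 (spurious 5 3 9) (split 5 13 (split 4 5 (split 5 12 (spurious 5 12 14) (split 6
  12 (spurious 6 12 14) (split 1 8 (spurious 7 1 8) (split 8 14 (spurious 7 14 8) (split 4 10
  (spurious 10 4 15) (split 3 7 (shortCycle (3 ∷ 7 ∷ 13 ∷ [])) (found (there (here refl)))))))))
  (unrealised 5 15)) (unrealised 3 5))))) (unrealised 10 14)))) (unrealised 2 15))))) (unrealised 9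
  15)) (unrealised 9 15)) (unrealised 7 12)))) (unrealised 2 9)))) (unrealised 11 14)) (unrealised 1
  13)) (unrealised 1 13))))) (unrealised 4 14)) (unrealised 4 14)) (unrealised 4 8)) (unrealised 1
  4)) (unrealised 1 4)))))) (unrealised 3 10))) (split 4 10 (split 4 12 (split 6 12 (split 5 12
  (split 12 15 (split 1 15 (spurious 1 15 12) (split 2 15 (split 3 15 (spurious 2 15 3) (split 4 15
  (spurious 2 15 4) (split 5 15 (spurious 2 15 5) (split 3 4 (spurious 3 4 12) (split 3 13 (split 3
  5 (spurious 3 5 12) (split 12 13 (spurious 3 13 12) (split 7 13 (split 7 15 (split 2 7 (spurious 2
  7 13) (split 1 7 (split 5 7 (spurious 1 7 5) (split 5 13 (split 7 9 (spurious 1 7 9) (split 7 12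
  (spurious 1 7 12) (split 4 13 (spurious 4 13 7) (split 9 12 (spurious 4 12 9) (split 9 15 (split
  12 14 (spurious 5 12 14) (split 4 14 (split 2 14 (spurious 2 14 4) (split 2 8 (split 8 14 (split 1
  14 (split 9 14 (spurious 1 14 9) (split 3 9 (split 3 14 (split 3 8 (spurious 2 8 3) (split 4 8
  (spurious 2 8 4) (split 7 14 (spurious 4 14 7) (split 4 5 (spurious 5 4 14) (split 13 14 (spurious
  5 13 14) (split 1 8 (spurious 7 1 8) (split 8 15 (spurious 7 15 8) (split 10 12 (spurious 10 12
  15) (split 3 7 (shortCycle (3 ∷ 7 ∷ 13 ∷ [])) (found (here refl))))))))))) (unrealised 9 14))
  (unrealised 3 9))) (unrealised 11 14)) (unrealised 2 14)) (unrealised 2 14))) (unrealised 12 14)))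
  (unrealised 9 15)))))) (unrealised 3 5))) (unrealised 7 11))) (unrealised 13 15)) (unrealised 13
  15)))) (unrealised 3 10)))))) (unrealised 11 15))) (unrealised 6 15)) (unrealised 5 6))
  (unrealised 4 6)) (unrealised 4 6)) (unrealised 0 4)))))))))))) (unrealised 0 13)) (unrealised 0
  1))))))))) (unrealised 10 11)) (unrealised 6 11)))) (unrealised 0 2)))))))) (split 0 12 (split 2
  12 (split 5 12 (spurious 0 12 5) (split 7 12 (spurious 0 12 7) (split 9 12 (spurious 0 12 9)
  (split 12 14 (spurious 0 12 14) (split 12 15 (spurious 0 12 15) (split 1 2 (spurious 1 2 12)
  (split 4 12 (spurious 2 12 4) (split 6 12 (spurious 2 12 6) (split 10 12 (spurious 2 12 10) (split
  5 13 (split 12 13 (spurious 2 12 13) (unrealised 5 12)) (unrealised 5 12))))))))))) (unrealised 0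
  2)) (unrealised 0 2)))))

squareRoot≗𝒢₁⊎𝒢₂ : (H : Graph 16) → IsSimple H → Girth≡ H 5 → (∀ x y → square H x y ≡ 𝔊 x y) →
                    Any (λ G → ∀ x y → H x y ≡ G x y) (𝒢₁ ∷ 𝒢₂ ∷ [])
squareRoot≗𝒢₁⊎𝒢₂ H simple girth H²≡𝔊 = sound certificate initial-consistent _
  -- The last argument is solved by eta for ⊤ once Agda has evaluated the certificate check.
  where open Soundness H simple (proj₂ girth) H²≡𝔊

theorem1 : (H : Graph 16) → IsSimple H → Girth≡ H 5 →
    (∀ x y → square H x y ≡ 𝔊 x y) →
    Isomorphic H 𝒢₁ ⊎ Isomorphic H 𝒢₂
theorem1 H simple girth H²≡𝔊 with squareRoot≗𝒢₁⊎𝒢₂ H simple girth H²≡𝔊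
... | here H≗𝒢₁         = inj₁ (≗⇒Isomorphic H≗𝒢₁)
... | there (here H≗𝒢₂) = inj₂ (≗⇒Isomorphic H≗𝒢₂)
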